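{- Assume $n\in\mathbb{N}$ is squarefree. Then $a(0,n)=1$, and the coefficient triple $\bigl(a(1,n),a(2,n),a(3,n)\bigr)$ has exactly one of the following eight values: $(1,1,1),\ (1,1,0),\ (1,0,0),\ (1,0,-1),\ (-1,1,0),\ (-1,1,-1),\ (-1,0,1),\ (-1,0,0)$.
   Context: For $n\in\mathbb{N}$, $\Phi_n(z)=\prod_{1\le j\le n,\ \gcd(j,n)=1}(z-e^{2\pi i j/n})$ is the $n$-th cyclotomic polynomial, of degree $\varphi(n)$ (Euler totient). Its coefficients are labelled $a(j,n)$ via $\Phi_n(z)=\sum_{j=0}^{\varphi(n)}a(j,n)z^{\varphi(n)-j}$ (so $a(j,n)$ is the coefficient of $z^{\varphi(n)-j}$), and $a(j,n)=0$ for $j>\varphi(n)$. An integer is squarefree if it is not divisible by $p^2$ for any prime $p$. -}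

module Defs where

open import Data.Nat as ℕ using (ℕ; zero; suc; _∸_; _≤ᵇ_)
open import Data.Nat.Divisibility using (_∣_; _∣?_)
open import Data.Nat.Primality using (Prime)
open import Data.Integer as ℤ using (ℤ; +_; -_)
open import Data.List using (List; []; _∷_; _∷ʳ_; map; replicate; length; reverse; foldr)
open import Data.Product using (_×_; _,_)
open import Data.Bool using (if_then_else_)
open import Relation.Nullary using (¬_; does)

-- Integer polynomials as coefficient lists, LOW-to-HIGH degree.
Poly : Set
Poly = List ℤ

addP : Poly → Poly → Poly
addP []       q        = q
addP p        []       = p
addP (a ∷ p)  (b ∷ q)  = (a ℤ.+ b) ∷ addP p q

mulP : Poly → Poly → Poly
mulP []      q = []
mulP (a ∷ p) q = addP (map (a ℤ.*_) q) (+ 0 ∷ mulP p q)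

prodP : List Poly → Poly
prodP = foldr mulP (+ 1 ∷ [])

zPowMinusOne : ℕ → Poly
zPowMinusOne m = (- + 1) ∷ (replicate (m ∸ 1) (+ 0) ∷ʳ + 1)

-- Long division by a MONIC divisor, both in HIGH-to-LOW form.
-- ds = divisor without its leading 1; m = number of quotient coefficients.
subPrefix : List ℤ → List ℤ → List ℤ
subPrefix (a ∷ as) (b ∷ bs) = (a ℤ.- b) ∷ subPrefix as bs
subPrefix as       []       = as
subPrefix []       bs       = map -_ bs

longDiv : List ℤ → ℕ → List ℤ → List ℤ
longDiv ds zero    f       = []
longDiv ds (suc m) []      = []
longDiv ds (suc m) (c ∷ f) = c ∷ longDiv ds m (subPrefix f (map (c ℤ.*_) ds))

-- quotient f / g for monic g (low-to-high in, low-to-high out)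
divP : Poly → Poly → Poly
divP f g with reverse g
... | []      = []
... | _ ∷ ds  = reverse (longDiv ds (suc (length f) ∸ length g) (reverse f))

-- Cyclotomic polynomials via  z^n - 1 = ∏_{d ∣ n} Φ_d :
-- Φ_n = (z^n - 1) / ∏_{d ∣ n, d < n} Φ_d .
-- table n = [(1, Φ_1), …, (n, Φ_n)]
cycloStep : ℕ → List (ℕ × Poly) → Poly
cycloStep n tbl =
  divP (zPowMinusOne (suc n))
       (prodP (foldr (λ { (d , p) acc → if does (d ∣? suc n) then p ∷ acc else acc }) [] tbl))

table : ℕ → List (ℕ × Poly)
table zero    = []
table (suc n) = table n ∷ʳ (suc n , cycloStep n (table n))

-- Φ n (low-to-high coefficients); Φ 0 is a junk value (n = 0 never used).
Φ : ℕ → Poly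
Φ zero    = + 1 ∷ []
Φ (suc n) = cycloStep n (table n)

coeffAt : Poly → ℕ → ℤ
coeffAt []      k       = + 0
coeffAt (a ∷ p) zero    = a
coeffAt (a ∷ p) (suc k) = coeffAt p k

degree : Poly → ℕ
degree p = length p ∸ 1

a : ℕ → ℕ → ℤ
a j n = if j ≤ᵇ degree (Φ n) then coeffAt (Φ n) (degree (Φ n) ∸ j) else + 0

Squarefree : ℕ → Set
Squarefree n = ∀ p → Prime p → ¬ (p ℕ.* p ∣ n)

-- Put t = 1/z. For monic p the coefficients a(1), a(2), a(3) are those of the reversed polynomial t^(deg p) p(1/t)
-- modulo t⁴; this jet lies in the unit group 1 + t ℤ[t]/(t⁴) and is multiplicative. By z^N − 1 = ∏_{d ∣ N} Φ_d the jets
-- of the Φ_d have divisor products 1 − t^N, and for N = p M with p prime, p ∤ M, induction over the divisors of M turns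
-- this into jet Φ_N · jet Φ_M = (jet Φ_M)(t^p); the same argument on degrees gives deg Φ_N = (p − 1) deg Φ_M.
-- Modulo t⁴ only 1 − t, 1 − t², 1 − t³ matter, so for squarefree N the jet of Φ_N is
-- ((1 − t)(1 − t²)^−[2 ∣ N] (1 − t³)^−[3 ∣ N])^±1, which gives the eight triples.
-- Φ_N is computed by long division, whose quotient reproduces the top coefficients of z^N − 1 whether or not the
-- division is exact; this needs deg Φ_N ≥ 3, and the remaining N = 1, 2, 3, 6 are evaluated directly.

module Submission where

open import Defs

open import Data.Nat as ℕ using (ℕ; zero; suc; _∸_; _≤_; _<_; z≤n; s≤s; _≤ᵇ_; NonZero)
import Data.Nat.Properties as ℕP
open import Data.Nat.Induction using (<-rec)
open import Data.Nat.Divisibility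
  using (_∣_; _∣?_; divides; ∣-refl; ∣-trans; ∣⇒≤; ∣m+n∣m⇒∣n; m∣m*n; n∣m*n; ∣n⇒∣m*n; *-monoʳ-∣; *-cancelˡ-∣; 0∣⇒≡0)
open import Data.Nat.Coprimality using (Coprime; coprime-divisor)
open import Data.Nat.Primality
  using (Prime; prime?; prime[2]; ¬prime[1]; euclidsLemma; prime⇒irreducible; prime⇒nonZero; prime⇒nonTrivial)
open import Data.Nat.Primality.Factorisation using (factorise)
open import Data.Nat.ListAction using (product)
open import Data.Integer as ℤ using (ℤ; +_; -_; _+_; _*_; _-_)
import Data.Integer.Properties as ℤP
open import Data.Integer.Tactic.RingSolver using (solve-∀)
open import Data.List using (List; []; _∷_; _∷ʳ_; map; replicate; length; reverse; foldr)
import Data.List.Properties as LP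
import Data.List.Relation.Unary.All as All
open import Data.List.Relation.Unary.Any using (here; there)
open import Data.List.Membership.Propositional using (_∈_)
open import Data.Bool using (Bool; true; false; if_then_else_)
open import Data.Product using (_×_; _,_; ∃; proj₁; proj₂)
open import Data.Sum using (_⊎_; inj₁; inj₂)
open import Function using (_∘_)
open import Function.Bundles using (mk⇔)
open import Level using (0ℓ)
open import Algebra.Bundles using (AbelianGroup; CommutativeSemigroup)
open import Algebra.Structures using (IsCommutativeMonoid; IsAbelianGroup)
import Algebra.Properties.AbelianGroup as AbelianGroupProperties
import Algebra.Properties.CommutativeSemigroup as CommutativeSemigroupProperties
open import Relation.Nullary using (¬_; yes; no; does; contradiction)
open import Relation.Nullary.Decidable using (dec-true; dec-false; does-⇔; from-yes)
open import Relation.Nullary.Reflects using (ofʸ; ofⁿ)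
open import Relation.Binary.PropositionalEquality
open ≡-Reasoning

open CommutativeSemigroupProperties ℤP.+-commutativeSemigroup using () renaming (interchange to +-interchange)

-- Coefficient sequences

shift : ℕ → (ℕ → ℤ) → ℕ → ℤ
shift zero    f j       = f j
shift (suc d) f zero    = + 0
shift (suc d) f (suc j) = shift d f j

single : ℕ → ℤ → ℕ → ℤ
single zero    x zero    = x
single zero    x (suc j) = + 0
single (suc d) x zero    = + 0
single (suc d) x (suc j) = single d x j

shift-cong : ∀ d {f g} → (∀ i → f i ≡ g i) → ∀ j → shift d f j ≡ shift d g j
shift-cong zero    f≗g j       = f≗g j
shift-cong (suc d) f≗g zero    = refl
shift-cong (suc d) f≗g (suc j) = shift-cong d f≗g j

shift-+ : ∀ d f g j → shift d (λ i → f i + g i) j ≡ shift d f j + shift d g j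
shift-+ zero    f g j       = refl
shift-+ (suc d) f g zero    = refl
shift-+ (suc d) f g (suc j) = shift-+ d f g j

shift-single : ∀ d L x j → shift d (single L x) j ≡ single (d ℕ.+ L) x j
shift-single zero    L x j       = refl
shift-single (suc d) L x zero    = refl
shift-single (suc d) L x (suc j) = shift-single d L x j

shift-zero : ∀ d j → shift d (λ _ → + 0) j ≡ + 0
shift-zero zero    j       = refl
shift-zero (suc d) zero    = refl
shift-zero (suc d) (suc j) = shift-zero d j

single-+ : ∀ L x y j → single L (x + y) j ≡ single L x j + single L y j
single-+ zero    x y zero    = refl
single-+ zero    x y (suc j) = refl
single-+ (suc L) x y zero    = refl
single-+ (suc L) x y (suc j) = single-+ L x y j

single-zero : ∀ L j → single L (+ 0) j ≡ + 0
single-zero zero    zero    = refl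
single-zero zero    (suc j) = refl
single-zero (suc L) zero    = refl
single-zero (suc L) (suc j) = single-zero L j

single-self : ∀ L x → single L x L ≡ x
single-self zero    x = refl
single-self (suc L) x = single-self L x

single-< : ∀ {j L} x → j < L → single L x j ≡ + 0
single-< {zero}  {suc L} x _         = refl
single-< {suc j} {suc L} x (s≤s j<L) = single-< x j<L

conv : (ℕ → ℤ) → (ℕ → ℤ) → ℕ → ℤ
conv f g zero    = f 0 * g 0
conv f g (suc k) = f 0 * g (suc k) + conv (f ∘ suc) g k

conv-congˡ : ∀ {f f′} g → (∀ i → f i ≡ f′ i) → ∀ k → conv f g k ≡ conv f′ g k
conv-congˡ g f≗f′ zero    = cong (_* g 0) (f≗f′ 0)
conv-congˡ g f≗f′ (suc k) =
  cong₂ (λ x y → x * g (suc k) + y) (f≗f′ 0) (conv-congˡ g (f≗f′ ∘ suc) k)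

conv-+ˡ : ∀ f h g k → conv (λ i → f i + h i) g k ≡ conv f g k + conv h g k
conv-+ˡ f h g zero    = ℤP.*-distribʳ-+ (g 0) (f 0) (h 0)
conv-+ˡ f h g (suc k) = begin
  (f 0 + h 0) * g (suc k) + conv (λ i → f (suc i) + h (suc i)) g k
    ≡⟨ cong₂ _+_ (ℤP.*-distribʳ-+ (g (suc k)) (f 0) (h 0)) (conv-+ˡ (f ∘ suc) (h ∘ suc) g k) ⟩
  (f 0 * g (suc k) + h 0 * g (suc k)) + (conv (f ∘ suc) g k + conv (h ∘ suc) g k)
    ≡⟨ +-interchange (f 0 * g (suc k)) (h 0 * g (suc k)) (conv (f ∘ suc) g k) (conv (h ∘ suc) g k) ⟩
  (f 0 * g (suc k) + conv (f ∘ suc) g k) + (h 0 * g (suc k) + conv (h ∘ suc) g k) ∎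

conv-zeroˡ : ∀ {f} g → (∀ i → f i ≡ + 0) → ∀ k → conv f g k ≡ + 0
conv-zeroˡ g f≗0 zero    = cong (_* g 0) (f≗0 0)
conv-zeroˡ {f} g f≗0 (suc k) = begin
  f 0 * g (suc k) + conv (f ∘ suc) g k ≡⟨ cong₂ (λ x y → x * g (suc k) + y) (f≗0 0) (conv-zeroˡ g (f≗0 ∘ suc) k) ⟩
  + 0 * g (suc k) + + 0               ≡⟨⟩
  + 0                                  ∎

conv-singleˡ : ∀ L a g k → conv (single L a) g k ≡ shift L (λ i → a * g i) k
conv-singleˡ zero    a g zero    = refl
conv-singleˡ zero    a g (suc k) = begin
  a * g (suc k) + conv (single 0 a ∘ suc) g k ≡⟨ cong (λ w → a * g (suc k) + w) (conv-zeroˡ g (λ _ → refl) k) ⟩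
  a * g (suc k) + + 0                         ≡⟨ ℤP.+-identityʳ _ ⟩
  a * g (suc k)                               ∎
conv-singleˡ (suc L) a g zero    = refl
conv-singleˡ (suc L) a g (suc k) = trans (ℤP.+-identityˡ _) (conv-singleˡ L a g k)


-- Polynomials as coefficient lists

coeffAt-∷ʳ : ∀ (l : Poly) x j → coeffAt (l ∷ʳ x) j ≡ coeffAt l j + single (length l) x j
coeffAt-∷ʳ []      x zero    = sym (ℤP.+-identityˡ x)
coeffAt-∷ʳ []      x (suc j) = refl
coeffAt-∷ʳ (y ∷ l) x zero    = sym (ℤP.+-identityʳ y)
coeffAt-∷ʳ (y ∷ l) x (suc j) = coeffAt-∷ʳ l x j

coeffAt-map : ∀ (f : ℤ → ℤ) → f (+ 0) ≡ + 0 → ∀ l j → coeffAt (map f l) j ≡ f (coeffAt l j)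
coeffAt-map f f0≡0 []      j       = sym f0≡0
coeffAt-map f f0≡0 (x ∷ l) zero    = refl
coeffAt-map f f0≡0 (x ∷ l) (suc j) = coeffAt-map f f0≡0 l j

coeffAt-≥length : ∀ (l : Poly) {j} → length l ≤ j → coeffAt l j ≡ + 0
coeffAt-≥length []      _         = refl
coeffAt-≥length (x ∷ l) (s≤s l≤j) = coeffAt-≥length l l≤j

-- topCoeff p j is the coefficient of z ^ (degree p ∸ j), i.e. a j n for p = Φ n.
topCoeff : Poly → ℕ → ℤ
topCoeff p = coeffAt (reverse p)

Monic : Poly → Set
Monic p = topCoeff p 0 ≡ + 1

topCoeff-∷ : ∀ x p j → topCoeff (x ∷ p) j ≡ topCoeff p j + single (length p) x j
topCoeff-∷ x p j = begin
  coeffAt (reverse (x ∷ p)) j                         ≡⟨ cong (λ l → coeffAt l j) (LP.unfold-reverse x p) ⟩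
  coeffAt (reverse p ∷ʳ x) j                          ≡⟨ coeffAt-∷ʳ (reverse p) x j ⟩
  topCoeff p j + single (length (reverse p)) x j      ≡⟨ cong (λ L → topCoeff p j + single L x j) (LP.length-reverse p) ⟩
  topCoeff p j + single (length p) x j                ∎

topCoeff-≥length : ∀ p {j} → length p ≤ j → topCoeff p j ≡ + 0
topCoeff-≥length p p≤j = coeffAt-≥length (reverse p) (subst (_≤ _) (sym (LP.length-reverse p)) p≤j)

topCoeff-<length : ∀ p {j} → j < length p → topCoeff p j ≡ coeffAt p (length p ∸ suc j)
topCoeff-<length (x ∷ p) {j} (s≤s j≤p) with ℕP.m≤n⇒m<n∨m≡n j≤p
... | inj₁ j<p = begin
  topCoeff (x ∷ p) j                                ≡⟨ topCoeff-∷ x p j ⟩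
  topCoeff p j + single (length p) x j              ≡⟨ cong₂ _+_ (topCoeff-<length p j<p) (single-< x j<p) ⟩
  coeffAt p (length p ∸ suc j) + + 0                ≡⟨ ℤP.+-identityʳ _ ⟩
  coeffAt p (length p ∸ suc j)                      ≡⟨ cong (coeffAt (x ∷ p)) (sym (ℕP.+-∸-assoc 1 j<p)) ⟩
  coeffAt (x ∷ p) (length p ∸ j)                    ∎
... | inj₂ refl = begin
  topCoeff (x ∷ p) j                                ≡⟨ topCoeff-∷ x p j ⟩
  topCoeff p j + single j x j                       ≡⟨ cong₂ _+_ (topCoeff-≥length p ℕP.≤-refl) (single-self j x) ⟩
  + 0 + x                                           ≡⟨ ℤP.+-identityˡ x ⟩
  x                                                 ≡⟨ cong (coeffAt (x ∷ p)) (sym (ℕP.n∸n≡0 j)) ⟩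
  coeffAt (x ∷ p) (j ∸ j)                           ∎

topCoeff-map-* : ∀ a q j → topCoeff (map (a *_) q) j ≡ a * topCoeff q j
topCoeff-map-* a q j = begin
  coeffAt (reverse (map (a *_) q)) j  ≡⟨ cong (λ l → coeffAt l j) (LP.reverse-map (a *_) q) ⟨
  coeffAt (map (a *_) (reverse q)) j  ≡⟨ coeffAt-map (a *_) (ℤP.*-zeroʳ a) (reverse q) j ⟩
  a * topCoeff q j                    ∎

addP-[] : ∀ p → addP p [] ≡ p
addP-[] []      = refl
addP-[] (x ∷ p) = refl

length-addP : ∀ (u v : Poly) → length u ≤ length v → length (addP u v) ≡ length v
length-addP []      v       _         = refl
length-addP (a ∷ u) (b ∷ v) (s≤s u≤v) = cong suc (length-addP u v u≤v)

-- addP aligns constant terms, so seen from the top the shorter summand is shifted.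
topCoeff-addP : ∀ (u v : Poly) → length u ≤ length v → ∀ j →
                topCoeff (addP u v) j ≡ topCoeff v j + shift (length v ∸ length u) (topCoeff u) j
topCoeff-addP []      v       _         j = begin
  topCoeff v j                              ≡⟨ ℤP.+-identityʳ _ ⟨
  topCoeff v j + + 0                        ≡⟨ cong (λ w → topCoeff v j + w) (shift-zero (length v) j) ⟨
  topCoeff v j + shift (length v) (topCoeff []) j ∎
topCoeff-addP (a ∷ u) (b ∷ v) (s≤s u≤v) j = begin
  topCoeff ((a + b) ∷ addP u v) j
    ≡⟨ topCoeff-∷ (a + b) (addP u v) j ⟩
  topCoeff (addP u v) j + single (length (addP u v)) (a + b) j
    ≡⟨ cong₂ (λ x L → x + single L (a + b) j) (topCoeff-addP u v u≤v j) (length-addP u v u≤v) ⟩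
  (topCoeff v j + shift d (topCoeff u) j) + single (length v) (a + b) j
    ≡⟨ cong (λ w → (topCoeff v j + shift d (topCoeff u) j) + w) (single-+ (length v) a b j) ⟩
  (topCoeff v j + shift d (topCoeff u) j) + (single (length v) a j + single (length v) b j)
    ≡⟨ regroup (topCoeff v j) (shift d (topCoeff u) j) (single (length v) a j) (single (length v) b j) ⟩
  (topCoeff v j + single (length v) b j) + (shift d (topCoeff u) j + single (length v) a j)
    ≡⟨ cong₂ _+_ (topCoeff-∷ b v j) shifted-∷ ⟨
  topCoeff (b ∷ v) j + shift d (topCoeff (a ∷ u)) j ∎
  where
  d : ℕ
  d = length v ∸ length u
  regroup : ∀ w x y z → (w + x) + (y + z) ≡ (w + z) + (x + y)
  regroup = solve-∀
  shifted-∷ : shift d (topCoeff (a ∷ u)) j ≡ shift d (topCoeff u) j + single (length v) a j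
  shifted-∷ = begin
    shift d (topCoeff (a ∷ u)) j
      ≡⟨ shift-cong d (topCoeff-∷ a u) j ⟩
    shift d (λ i → topCoeff u i + single (length u) a i) j
      ≡⟨ shift-+ d _ _ j ⟩
    shift d (topCoeff u) j + shift d (single (length u) a) j
      ≡⟨ cong (λ w → shift d (topCoeff u) j + w) (shift-single d (length u) a j) ⟩
    shift d (topCoeff u) j + single (d ℕ.+ length u) a j
      ≡⟨ cong (λ L → shift d (topCoeff u) j + single L a j) (ℕP.m∸n+n≡m u≤v) ⟩
    shift d (topCoeff u) j + single (length v) a j ∎

length-mulP : ∀ a p b q → length (mulP (a ∷ p) (b ∷ q)) ≡ suc (length p ℕ.+ length q)
length-mulP a []       b q = cong suc (trans (cong length (addP-[] (map (a *_) q))) (LP.length-map (a *_) q))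
length-mulP a (a′ ∷ p) b q = trans (length-addP u v (ℕP.<⇒≤ u<v)) (cong suc (length-mulP a′ p b q))
  where
  u v : Poly
  u = map (a *_) (b ∷ q)
  v = + 0 ∷ mulP (a′ ∷ p) (b ∷ q)
  u<v : length u < length v
  u<v rewrite LP.length-map (a *_) q | length-mulP a′ p b q = s≤s (s≤s (ℕP.m≤n+m (length q) (length p)))

topCoeff-0∷ : ∀ p j → topCoeff (+ 0 ∷ p) j ≡ topCoeff p j
topCoeff-0∷ p j = begin
  topCoeff (+ 0 ∷ p) j                    ≡⟨ topCoeff-∷ (+ 0) p j ⟩
  topCoeff p j + single (length p) (+ 0) j ≡⟨ cong (λ w → topCoeff p j + w) (single-zero (length p) j) ⟩
  topCoeff p j + + 0                      ≡⟨ ℤP.+-identityʳ _ ⟩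
  topCoeff p j                            ∎

topCoeff-singleton : ∀ a i → topCoeff (a ∷ []) i ≡ single 0 a i
topCoeff-singleton a zero    = refl
topCoeff-singleton a (suc i) = refl

topCoeff-mulP : ∀ a p b q j →
                topCoeff (mulP (a ∷ p) (b ∷ q)) j ≡ conv (topCoeff (a ∷ p)) (topCoeff (b ∷ q)) j
topCoeff-mulP a [] b q j = begin
  topCoeff ((a * b + + 0) ∷ addP (map (a *_) q) []) j
    ≡⟨ cong₂ (λ x l → topCoeff (x ∷ l) j) (ℤP.+-identityʳ (a * b)) (addP-[] (map (a *_) q)) ⟩
  topCoeff (map (a *_) (b ∷ q)) j
    ≡⟨ topCoeff-map-* a (b ∷ q) j ⟩
  a * topCoeff (b ∷ q) j
    ≡⟨ conv-singleˡ 0 a (topCoeff (b ∷ q)) j ⟨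
  conv (single 0 a) (topCoeff (b ∷ q)) j
    ≡⟨ conv-congˡ (topCoeff (b ∷ q)) (topCoeff-singleton a) j ⟨
  conv (topCoeff (a ∷ [])) (topCoeff (b ∷ q)) j ∎
topCoeff-mulP a (a′ ∷ p) b q j = begin
  topCoeff (addP u v) j
    ≡⟨ topCoeff-addP u v u≤v j ⟩
  topCoeff v j + shift (length v ∸ length u) (topCoeff u) j
    ≡⟨ cong₂ _+_ (topCoeff-0∷ (mulP (a′ ∷ p) (b ∷ q)) j) (cong (λ d → shift d (topCoeff u) j) gap) ⟩
  topCoeff (mulP (a′ ∷ p) (b ∷ q)) j + shift L (topCoeff u) j
    ≡⟨ cong₂ _+_ (topCoeff-mulP a′ p b q j) (shift-cong L (topCoeff-map-* a (b ∷ q)) j) ⟩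
  conv (topCoeff (a′ ∷ p)) g j + shift L (λ i → a * g i) j
    ≡⟨ cong (λ w → conv (topCoeff (a′ ∷ p)) g j + w) (conv-singleˡ L a g j) ⟨
  conv (topCoeff (a′ ∷ p)) g j + conv (single L a) g j
    ≡⟨ conv-+ˡ (topCoeff (a′ ∷ p)) (single L a) g j ⟨
  conv (λ i → topCoeff (a′ ∷ p) i + single L a i) g j
    ≡⟨ conv-congˡ g (topCoeff-∷ a (a′ ∷ p)) j ⟨
  conv (topCoeff (a ∷ a′ ∷ p)) g j ∎
  where
  u v : Poly
  u = map (a *_) (b ∷ q)
  v = + 0 ∷ mulP (a′ ∷ p) (b ∷ q)
  g : ℕ → ℤ
  g = topCoeff (b ∷ q)
  L : ℕ
  L = length (a′ ∷ p)
  length-u : length u ≡ suc (length q)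
  length-u = cong suc (LP.length-map (a *_) q)
  length-v : length v ≡ suc (L ℕ.+ length q)
  length-v = cong suc (length-mulP a′ p b q)
  u≤v : length u ≤ length v
  u≤v = subst₂ _≤_ (sym length-u) (sym length-v) (s≤s (ℕP.m≤n+m (length q) L))
  gap : length v ∸ length u ≡ L
  gap = trans (cong₂ _∸_ length-v length-u) (ℕP.m+n∸n≡m L (length q))

monic-mulP : ∀ p q → Monic p → Monic q → Monic (mulP p q)
monic-mulP (a ∷ p) (b ∷ q) p-monic q-monic = trans (topCoeff-mulP a p b q 0) (cong₂ _*_ p-monic q-monic)

degree-mulP : ∀ p q → Monic p → Monic q → degree (mulP p q) ≡ degree p ℕ.+ degree q
degree-mulP (a ∷ p) (b ∷ q) _ _ = cong (_∸ 1) (length-mulP a p b q)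

coeffAt-subPrefix : ∀ as bs k → coeffAt (subPrefix as bs) k ≡ coeffAt as k - coeffAt bs k
coeffAt-subPrefix []       []       k       = refl
coeffAt-subPrefix []       (b ∷ bs) k       = trans (coeffAt-map -_ refl (b ∷ bs) k) (sym (ℤP.+-identityˡ _))
coeffAt-subPrefix (a ∷ as) []       k       = sym (ℤP.+-identityʳ _)
coeffAt-subPrefix (a ∷ as) (b ∷ bs) zero    = refl
coeffAt-subPrefix (a ∷ as) (b ∷ bs) (suc k) = coeffAt-subPrefix as bs k

length-subPrefix : ∀ as bs → length as ≤ length (subPrefix as bs)
length-subPrefix []       bs       = z≤n
length-subPrefix (a ∷ as) []       = ℕP.≤-refl
length-subPrefix (a ∷ as) (b ∷ bs) = s≤s (length-subPrefix as bs)

length-longDiv : ∀ ds m f → m ≤ length f → length (longDiv ds m f) ≡ m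
length-longDiv ds zero    f       _       = refl
length-longDiv ds (suc m) (c ∷ f) (s≤s m≤f) =
  cong suc (length-longDiv ds m _ (ℕP.≤-trans m≤f (length-subPrefix f (map (c *_) ds))))

-- Whether or not the division is exact, the first m coefficients of f are reproduced.
longDiv-conv : ∀ ds m f k → k < m → conv (coeffAt (longDiv ds m f)) (coeffAt (+ 1 ∷ ds)) k ≡ coeffAt f k
longDiv-conv ds (suc m) []      k       _       = conv-zeroˡ (coeffAt (+ 1 ∷ ds)) (λ _ → refl) k
longDiv-conv ds (suc m) (c ∷ f) zero    _       = ℤP.*-identityʳ c
longDiv-conv ds (suc m) (c ∷ f) (suc k) (s≤s k<m) = begin
  c * coeffAt ds k + conv (coeffAt (longDiv ds m f′)) (coeffAt (+ 1 ∷ ds)) k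
    ≡⟨ cong (λ w → c * coeffAt ds k + w) (longDiv-conv ds m f′ k k<m) ⟩
  c * coeffAt ds k + coeffAt f′ k
    ≡⟨ cong (λ w → c * coeffAt ds k + w) (coeffAt-subPrefix f (map (c *_) ds) k) ⟩
  c * coeffAt ds k + (coeffAt f k - coeffAt (map (c *_) ds) k)
    ≡⟨ cong (λ w → c * coeffAt ds k + (coeffAt f k - w)) (coeffAt-map (c *_) (ℤP.*-zeroʳ c) ds k) ⟩
  c * coeffAt ds k + (coeffAt f k - c * coeffAt ds k)
    ≡⟨ cancel (c * coeffAt ds k) (coeffAt f k) ⟩
  coeffAt f k ∎
  where
  f′ : List ℤ
  f′ = subPrefix f (map (c *_) ds)
  cancel : ∀ x y → x + (y - x) ≡ y
  cancel = solve-∀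

monic-reverse : ∀ p → Monic p → ∃ λ ds → reverse p ≡ + 1 ∷ ds
monic-reverse p monic with reverse p
... | x ∷ ds = ds , cong (_∷ ds) monic

divP-unfold : ∀ f g {c ds} → reverse g ≡ c ∷ ds →
              divP f g ≡ reverse (longDiv ds (suc (length f) ∸ length g) (reverse f))
divP-unfold f g rev-g rewrite rev-g = refl

length-monic : ∀ p → Monic p → length p ≡ suc (degree p)
length-monic (x ∷ p) _ = refl

module _ (f g : Poly) (f-monic : Monic f) (g-monic : Monic g) (g≤f : degree g ≤ degree f) where
  private
    ds : List ℤ
    ds = proj₁ (monic-reverse g g-monic)

    m : ℕ
    m = suc (degree f ∸ degree g)

    quotient : List ℤ
    quotient = longDiv ds m (reverse f)

    steps : suc (length f) ∸ length g ≡ m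
    steps = begin
      suc (length f) ∸ length g               ≡⟨ cong₂ (λ F G → suc F ∸ G) (length-monic f f-monic) (length-monic g g-monic) ⟩
      suc (degree f) ∸ degree g               ≡⟨ ℕP.+-∸-assoc 1 g≤f ⟩
      m                                       ∎

    divP≡quotient : divP f g ≡ reverse quotient
    divP≡quotient = trans (divP-unfold f g (proj₂ (monic-reverse g g-monic)))
                          (cong (λ k → reverse (longDiv ds k (reverse f))) steps)

    topCoeff-divP : ∀ k → topCoeff (divP f g) k ≡ coeffAt quotient k
    topCoeff-divP k = cong (λ h → coeffAt h k) (trans (cong reverse divP≡quotient) (LP.reverse-involutive quotient))

  divP-monic : Monic (divP f g)
  divP-monic = trans (topCoeff-divP 0) (cong (λ l → coeffAt (longDiv ds m l) 0) (proj₂ (monic-reverse f f-monic)))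

  degree-divP : degree (divP f g) ≡ degree f ∸ degree g
  degree-divP = cong (_∸ 1) (begin
    length (divP f g)           ≡⟨ cong length divP≡quotient ⟩
    length (reverse quotient)   ≡⟨ LP.length-reverse quotient ⟩
    length quotient             ≡⟨ length-longDiv ds m (reverse f) m≤f ⟩
    m                           ∎)
    where
    m≤f : m ≤ length (reverse f)
    m≤f = subst (m ≤_) (sym (trans (LP.length-reverse f) (length-monic f f-monic))) (s≤s (ℕP.m∸n≤m (degree f) (degree g)))

  divP-conv : ∀ k → k ≤ degree f ∸ degree g → conv (topCoeff (divP f g)) (topCoeff g) k ≡ topCoeff f k
  divP-conv k k≤ = begin
    conv (topCoeff (divP f g)) (topCoeff g) k
      ≡⟨ conv-congˡ (topCoeff g) topCoeff-divP k ⟩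
    conv (coeffAt quotient) (topCoeff g) k
      ≡⟨ cong (λ l → conv (coeffAt quotient) (coeffAt l) k) (proj₂ (monic-reverse g g-monic)) ⟩
    conv (coeffAt quotient) (coeffAt (+ 1 ∷ ds)) k
      ≡⟨ longDiv-conv ds m (reverse f) k (s≤s k≤) ⟩
    topCoeff f k ∎

replicate-∷ʳ : ∀ n (x : ℤ) → replicate n x ∷ʳ x ≡ x ∷ replicate n x
replicate-∷ʳ zero    x = refl
replicate-∷ʳ (suc n) x = cong (x ∷_) (replicate-∷ʳ n x)

reverse-replicate : ∀ n (x : ℤ) → reverse (replicate n x) ≡ replicate n x
reverse-replicate zero    x = refl
reverse-replicate (suc n) x = begin
  reverse (x ∷ replicate n x)   ≡⟨ LP.unfold-reverse x (replicate n x) ⟩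
  reverse (replicate n x) ∷ʳ x  ≡⟨ cong (_∷ʳ x) (reverse-replicate n x) ⟩
  replicate n x ∷ʳ x            ≡⟨ replicate-∷ʳ n x ⟩
  x ∷ replicate n x             ∎

coeffAt-replicate-0 : ∀ n k → coeffAt (replicate n (+ 0)) k ≡ + 0
coeffAt-replicate-0 zero    k       = refl
coeffAt-replicate-0 (suc n) zero    = refl
coeffAt-replicate-0 (suc n) (suc k) = coeffAt-replicate-0 n k

reverse-zPowMinusOne : ∀ n → reverse (zPowMinusOne (suc n)) ≡ + 1 ∷ (replicate n (+ 0) ∷ʳ - + 1)
reverse-zPowMinusOne n = begin
  reverse (- + 1 ∷ (replicate n (+ 0) ∷ʳ + 1))         ≡⟨ LP.unfold-reverse (- + 1) (replicate n (+ 0) ∷ʳ + 1) ⟩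
  reverse (replicate n (+ 0) ∷ʳ + 1) ∷ʳ - + 1          ≡⟨ cong (_∷ʳ - + 1) (LP.reverse-++ (replicate n (+ 0)) (+ 1 ∷ [])) ⟩
  (+ 1 ∷ reverse (replicate n (+ 0))) ∷ʳ - + 1         ≡⟨ cong (λ l → (+ 1 ∷ l) ∷ʳ - + 1) (reverse-replicate n (+ 0)) ⟩
  + 1 ∷ (replicate n (+ 0) ∷ʳ - + 1)                   ∎

zPowMinusOne-monic : ∀ n → Monic (zPowMinusOne (suc n))
zPowMinusOne-monic n = cong (λ l → coeffAt l 0) (reverse-zPowMinusOne n)

degree-zPowMinusOne : ∀ n → degree (zPowMinusOne (suc n)) ≡ suc n
degree-zPowMinusOne n = begin
  length (replicate n (+ 0) ∷ʳ + 1)    ≡⟨ LP.length-++ (replicate n (+ 0)) ⟩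
  length (replicate n (+ 0)) ℕ.+ 1     ≡⟨ cong (ℕ._+ 1) (LP.length-replicate n) ⟩
  n ℕ.+ 1                              ≡⟨ ℕP.+-comm n 1 ⟩
  suc n                                ∎

topCoeff-zPowMinusOne : ∀ n k → topCoeff (zPowMinusOne (suc n)) (suc k) ≡ single n (- + 1) k
topCoeff-zPowMinusOne n k = begin
  topCoeff (zPowMinusOne (suc n)) (suc k)
    ≡⟨ cong (λ l → coeffAt l (suc k)) (reverse-zPowMinusOne n) ⟩
  coeffAt (replicate n (+ 0) ∷ʳ - + 1) k
    ≡⟨ coeffAt-∷ʳ (replicate n (+ 0)) (- + 1) k ⟩
  coeffAt (replicate n (+ 0)) k + single (length (replicate n (+ 0))) (- + 1) k
    ≡⟨ cong₂ (λ x L → x + single L (- + 1) k) (coeffAt-replicate-0 n k) (LP.length-replicate n) ⟩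
  + 0 + single n (- + 1) k
    ≡⟨ ℤP.+-identityˡ _ ⟩
  single n (- + 1) k ∎

a≡topCoeff : ∀ j n → a j n ≡ topCoeff (Φ n) j
a≡topCoeff j n = fromTop (Φ n)
  where
  fromTop : ∀ p → (if j ≤ᵇ degree p then coeffAt p (degree p ∸ j) else + 0) ≡ topCoeff p j
  fromTop []      with j ≤ᵇ 0
  ... | true  = refl
  ... | false = refl
  fromTop (x ∷ p) with j ≤ᵇ length p | ℕP.≤ᵇ-reflects-≤ j (length p)
  ... | true  | ofʸ j≤p = sym (topCoeff-<length (x ∷ p) (s≤s j≤p))
  ... | false | ofⁿ j≰p = sym (topCoeff-≥length (x ∷ p) (ℕP.≰⇒> j≰p))


-- Divisibility

prime>1 : ∀ {p} → Prime p → 1 < p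
prime>1 {p} p-prime = ℕ.nonTrivial⇒n>1 p {{prime⇒nonTrivial p-prime}}

n<p*n : ∀ {p} n .{{_ : NonZero n}} → Prime p → n < p ℕ.* n
n<p*n {p} n p-prime = subst (n <_) (ℕP.*-comm n p) (ℕP.m<m*n n p (prime>1 p-prime))

∣-*-cancel-prime : ∀ {p d e} → Prime p → ¬ p ∣ d → d ∣ p ℕ.* e → d ∣ e
∣-*-cancel-prime {p} {d} p-prime p∤d = coprime-divisor coprime
  where
  coprime : Coprime d p
  coprime (c∣d , c∣p) with prime⇒irreducible p-prime c∣p
  ... | inj₁ c≡1 = c≡1
  ... | inj₂ refl = contradiction c∣d p∤d

∣⇒nonZero : ∀ {d n} .{{_ : NonZero n}} → d ∣ n → NonZero d
∣⇒nonZero {zero}  {n} 0∣n = contradiction (0∣⇒≡0 0∣n) (ℕ.≢-nonZero⁻¹ n)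
∣⇒nonZero {suc d}     _   = _

does-∣?-*-prime : ∀ {r p} M → Prime r → Prime p → r ≢ p → does (r ∣? p ℕ.* M) ≡ does (r ∣? M)
does-∣?-*-prime {r} {p} M r-prime p-prime r≢p = does-⇔ (mk⇔ cancel (∣n⇒∣m*n p)) (r ∣? p ℕ.* M) (r ∣? M)
  where
  cancel : r ∣ p ℕ.* M → r ∣ M
  cancel r∣pM with euclidsLemma p M r-prime r∣pM
  ... | inj₂ r∣M = r∣M
  ... | inj₁ r∣p with prime⇒irreducible p-prime r∣p
  ...   | inj₁ refl = contradiction r-prime ¬prime[1]
  ...   | inj₂ r≡p  = contradiction r≡p r≢p

prime[3] : Prime 3
prime[3] = from-yes (prime? 3)

squarefree-∣ : ∀ {d N} → Squarefree N → d ∣ N → Squarefree d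
squarefree-∣ N-squarefree d∣N p p-prime p²∣d = N-squarefree p p-prime (∣-trans p²∣d d∣N)

prime-split : ∀ N → 2 ≤ N → ∃ λ q → ∃ λ m → Prime (suc q) × N ≡ suc q ℕ.* suc m
prime-split 1 (s≤s ())
prime-split N@(suc (suc _)) _ with factorise N
... | record { factors = [] ; isFactorisation = () }
... | record { factors = 0 ∷ _ ; factorsPrime = () All.∷ _ }
... | record { factors = suc q ∷ ps ; isFactorisation = N≡ ; factorsPrime = p-prime All.∷ _ }
      with product ps | N≡
...   | zero  | N≡0  = contradiction (trans N≡0 (ℕP.*-zeroʳ q)) λ ()
...   | suc m | N≡pM = q , m , p-prime , N≡pM


-- Truncated power series

-- ⟨ x , y , z ⟩ stands for 1 + x t + y t² + z t³ in the unit group of ℤ[t]/(t⁴).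
record Jet : Set where
  constructor ⟨_,_,_⟩
  field
    c₁ c₂ c₃ : ℤ

infixl 7 _·_
infix  8 _⁻¹ʲ

_·_ : Jet → Jet → Jet
⟨ a , b , c ⟩ · ⟨ d , e , f ⟩ = ⟨ a + d , b + a * d + e , c + a * e + b * d + f ⟩

1ʲ : Jet
1ʲ = ⟨ + 0 , + 0 , + 0 ⟩

_⁻¹ʲ : Jet → Jet
⟨ a , b , c ⟩ ⁻¹ʲ = ⟨ - a , a * a - b , - (a * a * a) + + 2 * a * b - c ⟩

⟨⟩-cong : ∀ {a b c a′ b′ c′} → a ≡ a′ → b ≡ b′ → c ≡ c′ → ⟨ a , b , c ⟩ ≡ ⟨ a′ , b′ , c′ ⟩
⟨⟩-cong refl refl refl = refl

·-isAbelianGroup : IsAbelianGroup _≡_ _·_ 1ʲ _⁻¹ʲ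
·-isAbelianGroup = record
  { isGroup = record
    { isMonoid = record
      { isSemigroup = record
        { isMagma = record { isEquivalence = isEquivalence ; ∙-cong = cong₂ _·_ }
        ; assoc = ·-assoc
        }
      ; identity = ·-identityˡ , λ x → trans (·-comm x 1ʲ) (·-identityˡ x)
      }
    ; inverse = ·-inverseˡ , λ x → trans (·-comm x (x ⁻¹ʲ)) (·-inverseˡ x)
    ; ⁻¹-cong = cong _⁻¹ʲ
    }
  ; comm = ·-comm
  }
  where
  ·-assoc : ∀ s t u → (s · t) · u ≡ s · (t · u)
  ·-assoc ⟨ a , b , c ⟩ ⟨ d , e , f ⟩ ⟨ g , h , i ⟩ = ⟨⟩-cong (l₁ a d g) (l₂ a b d e g h) (l₃ a b c d e f g h i)
    where
    l₁ : ∀ a d g → (a + d) + g ≡ a + (d + g)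
    l₁ = solve-∀
    l₂ : ∀ a b d e g h → (b + a * d + e) + (a + d) * g + h ≡ b + a * (d + g) + (e + d * g + h)
    l₂ = solve-∀
    l₃ : ∀ a b c d e f g h i → (c + a * e + b * d + f) + (a + d) * h + (b + a * d + e) * g + i
                               ≡ c + a * (e + d * g + h) + b * (d + g) + (f + d * h + e * g + i)
    l₃ = solve-∀
  ·-comm : ∀ s t → s · t ≡ t · s
  ·-comm ⟨ a , b , c ⟩ ⟨ d , e , f ⟩ = ⟨⟩-cong (l₁ a d) (l₂ a b d e) (l₃ a b c d e f)
    where
    l₁ : ∀ a d → a + d ≡ d + a
    l₁ = solve-∀
    l₂ : ∀ a b d e → b + a * d + e ≡ e + d * a + b
    l₂ = solve-∀
    l₃ : ∀ a b c d e f → c + a * e + b * d + f ≡ f + d * b + e * a + c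
    l₃ = solve-∀
  ·-identityˡ : ∀ t → 1ʲ · t ≡ t
  ·-identityˡ ⟨ a , b , c ⟩ = ⟨⟩-cong (ℤP.+-identityˡ a) (ℤP.+-identityˡ b) (ℤP.+-identityˡ c)
  ·-inverseˡ : ∀ t → t ⁻¹ʲ · t ≡ 1ʲ
  ·-inverseˡ ⟨ a , b , c ⟩ = ⟨⟩-cong (l₁ a) (l₂ a b) (l₃ a b c)
    where
    l₁ : ∀ a → - a + a ≡ + 0
    l₁ = solve-∀
    l₂ : ∀ a b → (a * a - b) + (- a) * a + b ≡ + 0
    l₂ = solve-∀
    l₃ : ∀ a b c → (- (a * a * a) + + 2 * a * b - c) + (- a) * b + (a * a - b) * a + c ≡ + 0
    l₃ = solve-∀

·-abelianGroup : AbelianGroup 0ℓ 0ℓ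
·-abelianGroup = record { isAbelianGroup = ·-isAbelianGroup }

open AbelianGroup ·-abelianGroup using ()
  renaming (comm to ·-comm; inverseˡ to ·-inverseˡ; inverseʳ to ·-inverseʳ; isCommutativeMonoid to ·-isCommutativeMonoid)

open AbelianGroupProperties ·-abelianGroup using () renaming (∙-cancelʳ to ·-cancelʳ)

open CommutativeSemigroupProperties (AbelianGroup.commutativeSemigroup ·-abelianGroup)
  using () renaming (xy∙z≈xz∙y to xy·z≡xz·y)

jetOf : (ℕ → ℤ) → Jet
jetOf f = ⟨ f 1 , f 2 , f 3 ⟩

jetOf-conv : ∀ f g → f 0 ≡ + 1 → g 0 ≡ + 1 → jetOf (conv f g) ≡ jetOf f · jetOf g
jetOf-conv f g f0≡1 g0≡1 = ⟨⟩-cong c₁ c₂ c₃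
  where
  c₁ : f 0 * g 1 + f 1 * g 0 ≡ f 1 + g 1
  c₁ rewrite f0≡1 | g0≡1 = l (f 1) (g 1)
    where
    l : ∀ a b → + 1 * b + a * + 1 ≡ a + b
    l = solve-∀
  c₂ : f 0 * g 2 + (f 1 * g 1 + f 2 * g 0) ≡ f 2 + f 1 * g 1 + g 2
  c₂ rewrite f0≡1 | g0≡1 = l (f 1) (f 2) (g 1) (g 2)
    where
    l : ∀ a b c d → + 1 * d + (a * c + b * + 1) ≡ b + a * c + d
    l = solve-∀
  c₃ : f 0 * g 3 + (f 1 * g 2 + (f 2 * g 1 + f 3 * g 0)) ≡ f 3 + f 1 * g 2 + f 2 * g 1 + g 3
  c₃ rewrite f0≡1 | g0≡1 = l (f 1) (f 2) (f 3) (g 1) (g 2) (g 3)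
    where
    l : ∀ a b c d e f → + 1 * f + (a * e + (b * d + c * + 1)) ≡ c + a * e + b * d + f
    l = solve-∀

jet : Poly → Jet
jet p = jetOf (topCoeff p)

jet-mulP : ∀ p q → Monic p → Monic q → jet (mulP p q) ≡ jet p · jet q
jet-mulP (a ∷ p) (b ∷ q) p-monic q-monic = begin
  jet (mulP (a ∷ p) (b ∷ q))
    ≡⟨ ⟨⟩-cong (topCoeff-mulP a p b q 1) (topCoeff-mulP a p b q 2) (topCoeff-mulP a p b q 3) ⟩
  jetOf (conv (topCoeff (a ∷ p)) (topCoeff (b ∷ q)))
    ≡⟨ jetOf-conv (topCoeff (a ∷ p)) (topCoeff (b ∷ q)) p-monic q-monic ⟩
  jet (a ∷ p) · jet (b ∷ q) ∎

-- The jet of 1 − tⁿ, with the junk value 1ʲ at n = 0.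
oneMinusPow : ℕ → Jet
oneMinusPow n = jetOf (single n (- + 1))

jet-zPowMinusOne : ∀ n → jet (zPowMinusOne (suc n)) ≡ oneMinusPow (suc n)
jet-zPowMinusOne n = ⟨⟩-cong (topCoeff-zPowMinusOne n 0) (topCoeff-zPowMinusOne n 1) (topCoeff-zPowMinusOne n 2)

oneMinusPow-≥4 : ∀ {n} → 4 ≤ n → oneMinusPow n ≡ 1ʲ
oneMinusPow-≥4 (s≤s (s≤s (s≤s (s≤s _)))) = refl

-- The substitution t ↦ tᵏ (degenerate, constantly 1ʲ, at k = 0).
dilate : ℕ → Jet → Jet
dilate 1 t                 = t
dilate 2 ⟨ x , _ , _ ⟩     = ⟨ + 0 , x , + 0 ⟩
dilate 3 ⟨ x , _ , _ ⟩     = ⟨ + 0 , + 0 , x ⟩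
dilate _ _                 = 1ʲ

dilate-≥4 : ∀ {k} t → 4 ≤ k → dilate k t ≡ 1ʲ
dilate-≥4 t (s≤s (s≤s (s≤s (s≤s _)))) = refl

dilate-· : ∀ k s t → dilate k (s · t) ≡ dilate k s · dilate k t
dilate-· 0 s t = refl
dilate-· 1 s t = refl
dilate-· 2 ⟨ a , _ , _ ⟩ ⟨ d , _ , _ ⟩ = ⟨⟩-cong refl (l₂ a d) (l₃ a d)
  where
  l₂ : ∀ a d → a + d ≡ a + + 0 * + 0 + d
  l₂ = solve-∀
  l₃ : ∀ a d → + 0 ≡ + 0 + + 0 * d + a * + 0 + + 0
  l₃ = solve-∀
dilate-· 3 ⟨ a , _ , _ ⟩ ⟨ d , _ , _ ⟩ = ⟨⟩-cong refl refl (l₃ a d)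
  where
  l₃ : ∀ a d → a + d ≡ a + + 0 * + 0 + + 0 * + 0 + d
  l₃ = solve-∀
dilate-· (suc (suc (suc (suc k)))) s t = refl

dilate-1ʲ : ∀ k → dilate k 1ʲ ≡ 1ʲ
dilate-1ʲ 0 = refl
dilate-1ʲ 1 = refl
dilate-1ʲ 2 = refl
dilate-1ʲ 3 = refl
dilate-1ʲ (suc (suc (suc (suc k)))) = refl

dilate-oneMinusPow : ∀ k n → 2 ≤ k → 1 ≤ n → dilate k (oneMinusPow n) ≡ oneMinusPow (k ℕ.* n)
dilate-oneMinusPow 0 n () _
dilate-oneMinusPow 1 n (s≤s ()) _
dilate-oneMinusPow k 0 _ ()
dilate-oneMinusPow 2 1 _ _ = refl
dilate-oneMinusPow 2 2 _ _ = refl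
dilate-oneMinusPow 2 3 _ _ = refl
dilate-oneMinusPow 3 1 _ _ = refl
dilate-oneMinusPow 3 2 _ _ = refl
dilate-oneMinusPow 3 3 _ _ = refl
dilate-oneMinusPow k@(suc (suc k′)) n@(suc (suc (suc (suc _)))) _ _ =
  trans (dilate-1ʲ k) (sym (oneMinusPow-≥4 (ℕP.≤-trans (s≤s (s≤s (s≤s (s≤s z≤n)))) (ℕP.m≤n*m n k))))
dilate-oneMinusPow k@(suc (suc (suc (suc _)))) n@(suc _) _ _ =
  trans (dilate-≥4 (oneMinusPow n) 4≤k) (sym (oneMinusPow-≥4 (ℕP.≤-trans 4≤k (ℕP.m≤m*n k n))))
  where
  4≤k : 4 ≤ k
  4≤k = s≤s (s≤s (s≤s (s≤s z≤n)))

-- For squarefree n, ∏_{d ∣ n} (1 − t^d)^μ(n/d) modulo t⁴ is shapeJet (2 ∣ n) (3 ∣ n) to the power μ(n),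
-- since only d ≤ 3 contribute and μ(n/d) = μ(n) μ(d).
shapeJet : Bool → Bool → Jet
shapeJet b₂ b₃ = oneMinusPow 1 · divideBy b₂ (oneMinusPow 2) · divideBy b₃ (oneMinusPow 3)
  where
  divideBy : Bool → Jet → Jet
  divideBy b t = if b then t ⁻¹ʲ else 1ʲ

HasShape : Bool → Bool → Jet → Set
HasShape b₂ b₃ t = t ≡ shapeJet b₂ b₃ ⊎ t ≡ shapeJet b₂ b₃ ⁻¹ʲ

hasShape-dilate : ∀ k b₂ b₃ b₂′ b₃′ {s t} →
                  dilate k (shapeJet b₂ b₃) ≡ shapeJet b₂′ b₃′ ⁻¹ʲ · shapeJet b₂ b₃ →
                  dilate k (shapeJet b₂ b₃ ⁻¹ʲ) ≡ shapeJet b₂′ b₃′ · shapeJet b₂ b₃ ⁻¹ʲ →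
                  HasShape b₂ b₃ t → s · t ≡ dilate k t → HasShape b₂′ b₃′ s
hasShape-dilate k b₂ b₃ b₂′ b₃′ {s} dilate₊ _ (inj₁ refl) s·t≡ = inj₂ (·-cancelʳ _ s _ (trans s·t≡ dilate₊))
hasShape-dilate k b₂ b₃ b₂′ b₃′ {s} _ dilate₋ (inj₂ refl) s·t≡ = inj₁ (·-cancelʳ _ s _ (trans s·t≡ dilate₋))

shape-step : ∀ {p M s t} → Prime p → ¬ p ∣ M →
             HasShape (does (2 ∣? M)) (does (3 ∣? M)) t → s · t ≡ dilate p t →
             HasShape (does (2 ∣? (p ℕ.* M))) (does (3 ∣? (p ℕ.* M))) s
shape-step {0} ()
shape-step {1} ()
shape-step {2} {M} {s} {t} _ 2∤M shape s·t≡ =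
  subst₂ (λ b₂ b₃ → HasShape b₂ b₃ s) (sym 2∣2M) (sym 3∣2M)
         (hasShape-dilate 2 false b₃ true b₃ (dilate₊ b₃) (dilate₋ b₃) shape′ s·t≡)
  where
  b₃ : Bool
  b₃ = does (3 ∣? M)
  2∣2M : does (2 ∣? 2 ℕ.* M) ≡ true
  2∣2M = dec-true (2 ∣? 2 ℕ.* M) (m∣m*n M)
  3∣2M : does (3 ∣? 2 ℕ.* M) ≡ b₃
  3∣2M = does-∣?-*-prime M prime[3] prime[2] λ ()
  shape′ : HasShape false b₃ t
  shape′ = subst (λ b₂ → HasShape b₂ b₃ t) (dec-false (2 ∣? M) 2∤M) shape
  dilate₊ : ∀ b₃ → dilate 2 (shapeJet false b₃) ≡ shapeJet true b₃ ⁻¹ʲ · shapeJet false b₃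
  dilate₊ false = refl
  dilate₊ true  = refl
  dilate₋ : ∀ b₃ → dilate 2 (shapeJet false b₃ ⁻¹ʲ) ≡ shapeJet true b₃ · shapeJet false b₃ ⁻¹ʲ
  dilate₋ false = refl
  dilate₋ true  = refl
shape-step {3} {M} {s} {t} _ 3∤M shape s·t≡ =
  subst₂ (λ b₂ b₃ → HasShape b₂ b₃ s) (sym 2∣3M) (sym 3∣3M)
         (hasShape-dilate 3 b₂ false b₂ true (dilate₊ b₂) (dilate₋ b₂) shape′ s·t≡)
  where
  b₂ : Bool
  b₂ = does (2 ∣? M)
  2∣3M : does (2 ∣? 3 ℕ.* M) ≡ b₂
  2∣3M = does-∣?-*-prime M prime[2] prime[3] λ ()
  3∣3M : does (3 ∣? 3 ℕ.* M) ≡ true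
  3∣3M = dec-true (3 ∣? 3 ℕ.* M) (m∣m*n M)
  shape′ : HasShape b₂ false t
  shape′ = subst (λ b₃ → HasShape b₂ b₃ t) (dec-false (3 ∣? M) 3∤M) shape
  dilate₊ : ∀ b₂ → dilate 3 (shapeJet b₂ false) ≡ shapeJet b₂ true ⁻¹ʲ · shapeJet b₂ false
  dilate₊ false = refl
  dilate₊ true  = refl
  dilate₋ : ∀ b₂ → dilate 3 (shapeJet b₂ false ⁻¹ʲ) ≡ shapeJet b₂ true · shapeJet b₂ false ⁻¹ʲ
  dilate₋ false = refl
  dilate₋ true  = refl
shape-step {p@(suc (suc (suc (suc _))))} {M} {s} p-prime _ shape s·t≡ =
  subst₂ (λ b₂ b₃ → HasShape b₂ b₃ s) (sym 2∣pM) (sym 3∣pM)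
         (hasShape-dilate p b₂ b₃ b₂ b₃ (sym (·-inverseˡ B)) (sym (·-inverseʳ B)) shape s·t≡)
  where
  b₂ b₃ : Bool
  b₂ = does (2 ∣? M)
  b₃ = does (3 ∣? M)
  B : Jet
  B = shapeJet b₂ b₃
  2∣pM : does (2 ∣? p ℕ.* M) ≡ b₂
  2∣pM = does-∣?-*-prime M prime[2] p-prime λ ()
  3∣pM : does (3 ∣? p ℕ.* M) ≡ b₃
  3∣pM = does-∣?-*-prime M prime[3] p-prime λ ()

cyclotomicTriples : List (ℤ × ℤ × ℤ)
cyclotomicTriples =
  (+ 1 , + 1 , + 1) ∷ (+ 1 , + 1 , + 0) ∷ (+ 1 , + 0 , + 0) ∷ (+ 1 , + 0 , - + 1) ∷
  (- + 1 , + 1 , + 0) ∷ (- + 1 , + 1 , - + 1) ∷ (- + 1 , + 0 , + 1) ∷ (- + 1 , + 0 , + 0) ∷ []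

hasShape-triples : ∀ b₂ b₃ {t} → HasShape b₂ b₃ t → (Jet.c₁ t , Jet.c₂ t , Jet.c₃ t) ∈ cyclotomicTriples
hasShape-triples false false (inj₁ refl) = there (there (there (there (there (there (there (here refl)))))))
hasShape-triples false false (inj₂ refl) = here refl
hasShape-triples true  false (inj₁ refl) = there (there (there (there (there (here refl)))))
hasShape-triples true  false (inj₂ refl) = there (there (here refl))
hasShape-triples false true  (inj₁ refl) = there (there (there (there (there (there (here refl))))))
hasShape-triples false true  (inj₂ refl) = there (here refl)
hasShape-triples true  true  (inj₁ refl) = there (there (there (there (here refl))))
hasShape-triples true  true  (inj₂ refl) = there (there (there (here refl)))


-- Products over divisors

module DivisorProducts {A : Set} {_∙_ : A → A → A} {ε : A}
                       (isCommutativeMonoid : IsCommutativeMonoid _≡_ _∙_ ε) where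

  open IsCommutativeMonoid isCommutativeMonoid using (assoc; comm; identityˡ; identityʳ; isCommutativeSemigroup)
  private
    commutativeSemigroup : CommutativeSemigroup 0ℓ 0ℓ
    commutativeSemigroup = record { isCommutativeSemigroup = isCommutativeSemigroup }

  open CommutativeSemigroupProperties commutativeSemigroup using (interchange; xy∙z≈y∙xz; xy∙z≈zx∙y)

  ∏< : ℕ → (ℕ → A) → A
  ∏< zero    f = ε
  ∏< (suc n) f = ∏< n f ∙ f n

  ∏<-cong : ∀ n {f g} → (∀ i → i < n → f i ≡ g i) → ∏< n f ≡ ∏< n g
  ∏<-cong zero    f≗g = refl
  ∏<-cong (suc n) f≗g = cong₂ _∙_ (∏<-cong n (λ i i<n → f≗g i (ℕP.m<n⇒m<1+n i<n))) (f≗g n ℕP.≤-refl)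

  ∏<-ε : ∀ n {f} → (∀ i → i < n → f i ≡ ε) → ∏< n f ≡ ε
  ∏<-ε n f≗ε = trans (∏<-cong n f≗ε) (constant n)
    where
    constant : ∀ n → ∏< n (λ _ → ε) ≡ ε
    constant zero    = refl
    constant (suc n) = trans (cong (_∙ ε) (constant n)) (identityˡ ε)

  ∏<-∙ : ∀ n f g → ∏< n (λ i → f i ∙ g i) ≡ ∏< n f ∙ ∏< n g
  ∏<-∙ zero    f g = sym (identityˡ ε)
  ∏<-∙ (suc n) f g = trans (cong (_∙ (f n ∙ g n)) (∏<-∙ n f g)) (interchange _ _ _ _)

  ∏<-+ : ∀ m n f → ∏< (m ℕ.+ n) f ≡ ∏< m f ∙ ∏< n (λ i → f (m ℕ.+ i))
  ∏<-+ m zero    f = trans (cong (λ k → ∏< k f) (ℕP.+-identityʳ m)) (sym (identityʳ _))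
  ∏<-+ m (suc n) f = begin
    ∏< (m ℕ.+ suc n) f                                        ≡⟨ cong (λ k → ∏< k f) (ℕP.+-suc m n) ⟩
    ∏< (m ℕ.+ n) f ∙ f (m ℕ.+ n)                              ≡⟨ cong (_∙ f (m ℕ.+ n)) (∏<-+ m n f) ⟩
    (∏< m f ∙ ∏< n (λ i → f (m ℕ.+ i))) ∙ f (m ℕ.+ n)          ≡⟨ assoc _ _ _ ⟩
    ∏< m f ∙ ∏< (suc n) (λ i → f (m ℕ.+ i))                   ∎

  ∏<-vanishing-tail : ∀ m n f → (∀ i → i < n → f (m ℕ.+ i) ≡ ε) → ∏< (m ℕ.+ n) f ≡ ∏< m f
  ∏<-vanishing-tail m n f tail≗ε = begin
    ∏< (m ℕ.+ n) f                            ≡⟨ ∏<-+ m n f ⟩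
    ∏< m f ∙ ∏< n (λ i → f (m ℕ.+ i))         ≡⟨ cong (∏< m f ∙_) (∏<-ε n tail≗ε) ⟩
    ∏< m f ∙ ε                                ≡⟨ identityʳ _ ⟩
    ∏< m f                                    ∎

  ∏<-multiples : ∀ p K f → .{{NonZero p}} → (∀ k i → 0 < i → i < p → f (p ℕ.* k ℕ.+ i) ≡ ε) →
                 ∏< (p ℕ.* K) f ≡ ∏< K (λ k → f (p ℕ.* k))
  ∏<-multiples p       zero    f off≗ε = cong (λ k → ∏< k f) (ℕP.*-zeroʳ p)
  ∏<-multiples (suc q) (suc K) f off≗ε = begin
    ∏< (p ℕ.* suc K) f                                   ≡⟨ cong (λ k → ∏< k f) (trans (ℕP.*-suc p K) (ℕP.+-comm p _)) ⟩
    ∏< (p ℕ.* K ℕ.+ p) f                                 ≡⟨ ∏<-+ (p ℕ.* K) p f ⟩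
    ∏< (p ℕ.* K) f ∙ ∏< (suc q) (λ i → f (p ℕ.* K ℕ.+ i)) ≡⟨ cong₂ _∙_ (∏<-multiples p K f off≗ε) block ⟩
    ∏< K (λ k → f (p ℕ.* k)) ∙ f (p ℕ.* K)               ∎
    where
    p : ℕ
    p = suc q
    block : ∏< p (λ i → f (p ℕ.* K ℕ.+ i)) ≡ f (p ℕ.* K)
    block = begin
      ∏< (1 ℕ.+ q) (λ i → f (p ℕ.* K ℕ.+ i))
        ≡⟨ ∏<-vanishing-tail 1 q _ (λ i i<q → off≗ε K (suc i) (s≤s z≤n) (s≤s i<q)) ⟩
      ε ∙ f (p ℕ.* K ℕ.+ 0)
        ≡⟨ identityˡ _ ⟩
      f (p ℕ.* K ℕ.+ 0)
        ≡⟨ cong f (ℕP.+-identityʳ _) ⟩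
      f (p ℕ.* K) ∎

  ∏<-hom : ∀ (σ : A → A) → (∀ x y → σ (x ∙ y) ≡ σ x ∙ σ y) → σ ε ≡ ε →
           ∀ n f → σ (∏< n f) ≡ ∏< n (σ ∘ f)
  ∏<-hom σ σ-∙ σ-ε zero    f = σ-ε
  ∏<-hom σ σ-∙ σ-ε (suc n) f = trans (σ-∙ _ _) (cong (_∙ σ (f n)) (∏<-hom σ σ-∙ σ-ε n f))

  restrict : ℕ → (ℕ → A) → ℕ → A
  restrict N f d = if does (d ∣? N) then f d else ε

  restrict-∣ : ∀ {N d} f → d ∣ N → restrict N f d ≡ f d
  restrict-∣ {N} {d} f d∣N = cong (if_then f d else ε) (dec-true (d ∣? N) d∣N)

  restrict-∤ : ∀ {N d} f → ¬ d ∣ N → restrict N f d ≡ ε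
  restrict-∤ {N} {d} f d∤N = cong (if_then f d else ε) (dec-false (d ∣? N) d∤N)

  divisorProduct : ℕ → (ℕ → A) → A
  divisorProduct N f = ∏< (suc N) (restrict N f)

  properDivisorProduct : ℕ → (ℕ → A) → A
  properDivisorProduct N f = ∏< N (restrict N f)

  divisorProduct-proper : ∀ N f → divisorProduct N f ≡ properDivisorProduct N f ∙ f N
  divisorProduct-proper N f = cong (properDivisorProduct N f ∙_) (restrict-∣ f ∣-refl)

  -- For p ∤ E, a divisor of p E either divides E or is p times a divisor of E.
  properDivisorProduct-* : ∀ {p E} → Prime p → ¬ p ∣ E → .{{NonZero E}} → ∀ f →
    properDivisorProduct (p ℕ.* E) f ≡ divisorProduct E f ∙ properDivisorProduct E (f ∘ (p ℕ.*_))
  properDivisorProduct-* {p} {E} p-prime p∤E f = begin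
    ∏< (p ℕ.* E) (restrict (p ℕ.* E) f)
      ≡⟨ ∏<-cong (p ℕ.* E) (λ d _ → split d) ⟩
    ∏< (p ℕ.* E) (λ d → restrict E f d ∙ new d)
      ≡⟨ ∏<-∙ (p ℕ.* E) (restrict E f) new ⟩
    ∏< (p ℕ.* E) (restrict E f) ∙ ∏< (p ℕ.* E) new
      ≡⟨ cong₂ _∙_ old-part (∏<-multiples p E new new-off-multiples) ⟩
    divisorProduct E f ∙ ∏< E (λ k → new (p ℕ.* k))
      ≡⟨ cong (divisorProduct E f ∙_) (∏<-cong E (λ k _ → new-multiple k)) ⟩
    divisorProduct E f ∙ properDivisorProduct E (f ∘ (p ℕ.*_)) ∎
    where
    instance
      p-nonZero : NonZero p
      p-nonZero = prime⇒nonZero p-prime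

    new : ℕ → A
    new d = if does (d ∣? E) then ε else restrict (p ℕ.* E) f d

    split : ∀ d → restrict (p ℕ.* E) f d ≡ restrict E f d ∙ new d
    split d with d ∣? E
    ... | yes d∣E = trans (restrict-∣ f (∣n⇒∣m*n p d∣E)) (sym (identityʳ (f d)))
    ... | no  _   = sym (identityˡ _)

    old-part : ∏< (p ℕ.* E) (restrict E f) ≡ divisorProduct E f
    old-part = begin
      ∏< (p ℕ.* E) (restrict E f)
        ≡⟨ cong (λ k → ∏< k (restrict E f)) (ℕP.m+[n∸m]≡n E<pE) ⟨
      ∏< (suc E ℕ.+ (p ℕ.* E ∸ suc E)) (restrict E f)
        ≡⟨ ∏<-vanishing-tail (suc E) _ (restrict E f) (λ i _ → restrict-∤ f (too-big i)) ⟩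
      divisorProduct E f ∎
      where
      E<pE : E < p ℕ.* E
      E<pE = n<p*n E p-prime
      too-big : ∀ i → ¬ suc E ℕ.+ i ∣ E
      too-big i d∣E = ℕP.<⇒≱ (s≤s (ℕP.m≤m+n E i)) (∣⇒≤ d∣E)

    new-off-multiples : ∀ k i → 0 < i → i < p → new (p ℕ.* k ℕ.+ i) ≡ ε
    new-off-multiples k i 0<i i<p with (p ℕ.* k ℕ.+ i) ∣? E
    ... | yes _   = refl
    ... | no  d∤E = restrict-∤ f (d∤E ∘ ∣-*-cancel-prime p-prime p∤d)
      where
      p∤d : ¬ p ∣ p ℕ.* k ℕ.+ i
      p∤d p∣d = ℕP.<⇒≱ i<p (∣⇒≤ {{ℕ.>-nonZero 0<i}} (∣m+n∣m⇒∣n p∣d (m∣m*n k)))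

    new-multiple : ∀ k → new (p ℕ.* k) ≡ restrict E (f ∘ (p ℕ.*_)) k
    new-multiple k with (p ℕ.* k) ∣? E | k ∣? E
    ... | yes pk∣E | _       = contradiction (∣-trans (m∣m*n k) pk∣E) p∤E
    ... | no  _    | yes k∣E = restrict-∣ f (*-monoʳ-∣ p k∣E)
    ... | no  _    | no  k∤E = restrict-∤ f (k∤E ∘ *-cancelˡ-∣ p)

  -- The abstract form of Φ_{pE}(z) Φ_E(z) = Φ_E(z^p): T has divisor products u below p M, and σ plays z ↦ z^p.
  module Möbius (σ : A → A) (σ-∙ : ∀ x y → σ (x ∙ y) ≡ σ x ∙ σ y) (σ-ε : σ ε ≡ ε)
                (∙-cancelʳ : ∀ x y z → y ∙ x ≡ z ∙ x → y ≡ z)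
                {p M : ℕ} (p-prime : Prime p) .{{_ : NonZero M}} (p∤M : ¬ p ∣ M) (T u : ℕ → A)
                (σ-u : ∀ E → E ∣ M → σ (u E) ≡ u (p ℕ.* E))
                (divisorProduct-T : ∀ D → D ∣ p ℕ.* M → D < p ℕ.* M → divisorProduct D T ≡ u D) where

    private instance
      p-nonZero : NonZero p
      p-nonZero = prime⇒nonZero p-prime

    u-p*-∙-T : ∀ E → E ∣ M → (∀ d → d ∣ E → d < E → T (p ℕ.* d) ∙ T d ≡ σ (T d)) →
               u (p ℕ.* E) ∙ T E ≡ σ (T E) ∙ properDivisorProduct (p ℕ.* E) T
    u-p*-∙-T E E∣M smaller = begin
      u (p ℕ.* E) ∙ T E              ≡⟨ cong (_∙ T E) (σ-u E E∣M) ⟨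
      σ (u E) ∙ T E                  ≡⟨ cong (λ x → σ x ∙ T E) X∙TE≡uE ⟨
      σ (X ∙ T E) ∙ T E              ≡⟨ cong (_∙ T E) (σ-∙ X (T E)) ⟩
      (σ X ∙ σ (T E)) ∙ T E          ≡⟨ cong (λ x → (x ∙ σ (T E)) ∙ T E) Q∙X≡σX ⟨
      ((Q ∙ X) ∙ σ (T E)) ∙ T E      ≡⟨ xy∙z≈y∙xz (Q ∙ X) (σ (T E)) (T E) ⟩
      σ (T E) ∙ ((Q ∙ X) ∙ T E)      ≡⟨ cong (σ (T E) ∙_) (trans (assoc Q X (T E)) (cong (Q ∙_) X∙TE≡uE)) ⟩
      σ (T E) ∙ (Q ∙ u E)            ≡⟨ cong (σ (T E) ∙_) (trans (comm Q (u E)) (sym split)) ⟩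
      σ (T E) ∙ properDivisorProduct (p ℕ.* E) T ∎
      where
      instance
        E-nonZero : NonZero E
        E-nonZero = ∣⇒nonZero E∣M

      X Q : A
      X = properDivisorProduct E T
      Q = properDivisorProduct E (T ∘ (p ℕ.*_))

      divisorProduct-E : divisorProduct E T ≡ u E
      divisorProduct-E = divisorProduct-T E (∣n⇒∣m*n p E∣M) (ℕP.≤-<-trans (∣⇒≤ E∣M) (n<p*n M p-prime))

      X∙TE≡uE : X ∙ T E ≡ u E
      X∙TE≡uE = trans (sym (divisorProduct-proper E T)) divisorProduct-E

      split : properDivisorProduct (p ℕ.* E) T ≡ u E ∙ Q
      split = trans (properDivisorProduct-* p-prime (λ p∣E → p∤M (∣-trans p∣E E∣M)) T) (cong (_∙ Q) divisorProduct-E)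

      Q∙X≡σX : Q ∙ X ≡ σ X
      Q∙X≡σX = begin
        Q ∙ X                                                    ≡⟨ ∏<-∙ E _ _ ⟨
        ∏< E (λ d → restrict E (T ∘ (p ℕ.*_)) d ∙ restrict E T d) ≡⟨ ∏<-cong E pointwise ⟩
        ∏< E (σ ∘ restrict E T)                                  ≡⟨ ∏<-hom σ σ-∙ σ-ε E (restrict E T) ⟨
        σ X                                                      ∎
        where
        pointwise : ∀ d → d < E → restrict E (T ∘ (p ℕ.*_)) d ∙ restrict E T d ≡ σ (restrict E T d)
        pointwise d d<E with d ∣? E
        ... | yes d∣E = smaller d d∣E d<E
        ... | no  _   = trans (identityˡ ε) (sym σ-ε)

    T-p*-∙-T : ∀ E → E ∣ M → E < M → T (p ℕ.* E) ∙ T E ≡ σ (T E)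
    T-p*-∙-T = <-rec _ λ E rec E∣M E<M →
      let P : A
          P = properDivisorProduct (p ℕ.* E) T

          divisorProduct-pE : P ∙ T (p ℕ.* E) ≡ u (p ℕ.* E)
          divisorProduct-pE = trans (sym (divisorProduct-proper (p ℕ.* E) T))
                                    (divisorProduct-T (p ℕ.* E) (*-monoʳ-∣ p E∣M) (ℕP.*-monoʳ-< p E<M))
      in ∙-cancelʳ P _ _ (begin
        (T (p ℕ.* E) ∙ T E) ∙ P        ≡⟨ xy∙z≈zx∙y (T (p ℕ.* E)) (T E) P ⟩
        (P ∙ T (p ℕ.* E)) ∙ T E        ≡⟨ cong (_∙ T E) divisorProduct-pE ⟩
        u (p ℕ.* E) ∙ T E              ≡⟨ u-p*-∙-T E E∣M (λ d d∣E d<E → rec d<E (∣-trans d∣E E∣M) (ℕP.<-trans d<E E<M)) ⟩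
        σ (T E) ∙ P                    ∎)

    u-p*M-∙-T : u (p ℕ.* M) ∙ T M ≡ σ (T M) ∙ properDivisorProduct (p ℕ.* M) T
    u-p*M-∙-T = u-p*-∙-T M ∣-refl T-p*-∙-T


-- The factors of z ^ N − 1 in the computation of Φ N

-- The step function that cycloStep folds over the table is a pattern lambda in Defs, named here by its specification.
Φ-unfold : ∀ n → ∃ λ keep →
  (∀ d p acc → keep (d , p) acc ≡ (if does (d ∣? suc n) then p ∷ acc else acc)) ×
  Φ (suc n) ≡ divP (zPowMinusOne (suc n)) (prodP (foldr keep [] (table n)))
Φ-unfold n = _ , (λ _ _ _ → refl) , refl

module ProperFactors (n : ℕ) (keep : ℕ × Poly → List Poly → List Poly)
                     (keep-spec : ∀ d p acc → keep (d , p) acc ≡ (if does (d ∣? suc n) then p ∷ acc else acc))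
                     (monic-Φ : ∀ d → d ∣ suc n → d < suc n → Monic (Φ d)) where

  factors : ℕ → List Poly → List Poly
  factors k acc = foldr keep acc (table k)

  factors-suc : ∀ k acc → factors (suc k) acc ≡ factors k (keep (suc k , Φ (suc k)) acc)
  factors-suc k acc = LP.foldr-∷ʳ keep acc (suc k , Φ (suc k)) (table k)

  monic-keep : ∀ d acc → d < suc n → Monic (prodP acc) → Monic (prodP (keep (d , Φ d) acc))
  monic-keep d acc d<N acc-monic with d ∣? suc n | keep-spec d (Φ d) acc
  ... | yes d∣N | kept    = subst (Monic ∘ prodP) (sym kept) (monic-mulP (Φ d) (prodP acc) (monic-Φ d d∣N d<N) acc-monic)
  ... | no  _   | dropped = subst (Monic ∘ prodP) (sym dropped) acc-monic

  monic-factors : ∀ k → k < suc n → ∀ acc → Monic (prodP acc) → Monic (prodP (factors k acc))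
  monic-factors zero    _   acc acc-monic = acc-monic
  monic-factors (suc k) k<N acc acc-monic rewrite factors-suc k acc =
    monic-factors k (ℕP.<-trans (ℕP.n<1+n k) k<N) _ (monic-keep (suc k) acc k<N acc-monic)

  module Measure {A : Set} {_∙_ : A → A → A} {ε : A} (isCommutativeMonoid : IsCommutativeMonoid _≡_ _∙_ ε)
                 (μ : Poly → A) (μ-mulP : ∀ p q → Monic p → Monic q → μ (mulP p q) ≡ μ p ∙ μ q)
                 (μ-one : μ (+ 1 ∷ []) ≡ ε) where
    open IsCommutativeMonoid isCommutativeMonoid using (assoc; identityˡ; identityʳ)
    open DivisorProducts isCommutativeMonoid using (∏<; restrict; restrict-∤; properDivisorProduct)

    μ-keep : ∀ d acc → d < suc n → Monic (prodP acc) →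
             μ (prodP (keep (d , Φ d) acc)) ≡ restrict (suc n) (μ ∘ Φ) d ∙ μ (prodP acc)
    μ-keep d acc d<N acc-monic with d ∣? suc n | keep-spec d (Φ d) acc
    ... | yes d∣N | kept    = trans (cong (μ ∘ prodP) kept) (μ-mulP (Φ d) (prodP acc) (monic-Φ d d∣N d<N) acc-monic)
    ... | no  _   | dropped = trans (cong (μ ∘ prodP) dropped) (sym (identityˡ _))

    μ-factors : ∀ k → k < suc n → ∀ acc → Monic (prodP acc) →
                μ (prodP (factors k acc)) ≡ ∏< (suc k) (restrict (suc n) (μ ∘ Φ)) ∙ μ (prodP acc)
    μ-factors zero    _   acc _ = sym (begin
      (ε ∙ restrict (suc n) (μ ∘ Φ) 0) ∙ μ (prodP acc) ≡⟨ cong (λ x → (ε ∙ x) ∙ μ (prodP acc)) (restrict-∤ (μ ∘ Φ) 0∤N) ⟩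
      (ε ∙ ε) ∙ μ (prodP acc)                          ≡⟨ trans (cong (_∙ μ (prodP acc)) (identityˡ ε)) (identityˡ _) ⟩
      μ (prodP acc)                                    ∎)
      where
      0∤N : ¬ 0 ∣ suc n
      0∤N 0∣N = contradiction (0∣⇒≡0 0∣N) λ ()
    μ-factors (suc k) k<N acc acc-monic = begin
      μ (prodP (factors (suc k) acc))                      ≡⟨ cong (μ ∘ prodP) (factors-suc k acc) ⟩
      μ (prodP (factors k acc′))                           ≡⟨ μ-factors k k<N′ acc′ (monic-keep (suc k) acc k<N acc-monic) ⟩
      ∏< (suc k) R ∙ μ (prodP acc′)                        ≡⟨ cong (∏< (suc k) R ∙_) (μ-keep (suc k) acc k<N acc-monic) ⟩
      ∏< (suc k) R ∙ (R (suc k) ∙ μ (prodP acc))           ≡⟨ assoc _ _ _ ⟨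
      ∏< (suc (suc k)) R ∙ μ (prodP acc)                   ∎
      where
      R : ℕ → A
      R = restrict (suc n) (μ ∘ Φ)
      acc′ : List Poly
      acc′ = keep (suc k , Φ (suc k)) acc
      k<N′ : k < suc n
      k<N′ = ℕP.<-trans (ℕP.n<1+n k) k<N

    μ-properFactors : μ (prodP (factors n [])) ≡ properDivisorProduct (suc n) (μ ∘ Φ)
    μ-properFactors = begin
      μ (prodP (factors n []))                                   ≡⟨ μ-factors n ℕP.≤-refl [] refl ⟩
      properDivisorProduct (suc n) (μ ∘ Φ) ∙ μ (+ 1 ∷ [])        ≡⟨ cong (properDivisorProduct (suc n) (μ ∘ Φ) ∙_) μ-one ⟩
      properDivisorProduct (suc n) (μ ∘ Φ) ∙ ε                   ≡⟨ identityʳ _ ⟩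
      properDivisorProduct (suc n) (μ ∘ Φ)                       ∎


-- Induction over squarefree n

module ℕ-Products   = DivisorProducts ℕP.+-0-isCommutativeMonoid

module Jet-Products = DivisorProducts ·-isCommutativeMonoid

-- The squarefree n with φ n < 3, where the quotient Φ n is too short to carry the jet argument.
data SmallIndex : ℕ → Set where
  one   : SmallIndex 1
  two   : SmallIndex 2
  three : SmallIndex 3
  six   : SmallIndex 6

record Invariant (d : ℕ) : Set where
  field
    monic       : Monic (Φ d)
    degree-sum  : ℕ-Products.divisorProduct d (degree ∘ Φ) ≡ d
    jet-product : Jet-Products.divisorProduct d (jet ∘ Φ) ≡ oneMinusPow d
    size        : 3 ≤ degree (Φ d) ⊎ SmallIndex d
    shape       : HasShape (does (2 ∣? d)) (does (3 ∣? d)) (jet (Φ d))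

small-invariant : ∀ {d} → SmallIndex d → Invariant d
small-invariant one   = record { monic = refl; degree-sum = refl; jet-product = refl; size = inj₂ one;   shape = inj₁ refl }
small-invariant two   = record { monic = refl; degree-sum = refl; jet-product = refl; size = inj₂ two;   shape = inj₂ refl }
small-invariant three = record { monic = refl; degree-sum = refl; jet-product = refl; size = inj₂ three; shape = inj₂ refl }
small-invariant six   = record { monic = refl; degree-sum = refl; jet-product = refl; size = inj₂ six;   shape = inj₁ refl }

size-step : ∀ q {M} → Prime (suc q) → ¬ suc q ∣ M →
            3 ≤ degree (Φ M) ⊎ SmallIndex M → 3 ≤ q ℕ.* degree (Φ M) ⊎ SmallIndex (suc q ℕ.* M)
size-step 0 ()
size-step q@(suc _) _ _ (inj₁ 3≤deg) = inj₁ (ℕP.≤-trans 3≤deg (ℕP.m≤n*m _ q))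
size-step 1 _ _   (inj₂ one)   = inj₂ two
size-step 1 _ 2∤M (inj₂ two)   = contradiction ∣-refl 2∤M
size-step 1 _ _   (inj₂ three) = inj₂ six
size-step 1 _ 2∤M (inj₂ six)   = contradiction (divides 3 refl) 2∤M
size-step 2 _ _   (inj₂ one)   = inj₂ three
size-step 2 _ _   (inj₂ two)   = inj₂ six
size-step 2 _ 3∤M (inj₂ three) = contradiction ∣-refl 3∤M
size-step 2 _ 3∤M (inj₂ six)   = contradiction (divides 2 refl) 3∤M
size-step q@(suc (suc (suc _))) {M} _ _ (inj₂ small) =
  inj₁ (ℕP.≤-trans (s≤s (s≤s (s≤s z≤n))) (ℕP.m≤m*n q (degree (Φ M)) {{nonZero-degree small}}))
  where
  nonZero-degree : ∀ {d} → SmallIndex d → NonZero (degree (Φ d))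
  nonZero-degree one   = _
  nonZero-degree two   = _
  nonZero-degree three = _
  nonZero-degree six   = _

module InductionStep (q m : ℕ) (p-prime : Prime (suc q)) (p∤M : ¬ suc q ∣ suc m)
                     (smaller : ∀ d → d ∣ suc q ℕ.* suc m → d < suc q ℕ.* suc m → Invariant d) where
  p M N n : ℕ
  p = suc q
  M = suc m
  N = p ℕ.* M
  -- N reduces to suc n, so that Φ N unfolds.
  n = m ℕ.+ q ℕ.* M

  open Invariant

  keep : ℕ × Poly → List Poly → List Poly
  keep = proj₁ (Φ-unfold n)

  keep-spec : ∀ d p acc → keep (d , p) acc ≡ (if does (d ∣? N) then p ∷ acc else acc)
  keep-spec = proj₁ (proj₂ (Φ-unfold n))

  open ProperFactors n keep keep-spec (λ d d∣N d<N → monic (smaller d d∣N d<N))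

  g z^N-1 : Poly
  g = prodP (factors n [])
  z^N-1 = zPowMinusOne N

  K : ℕ
  K = q ℕ.* degree (Φ M)

  Φ-N : Φ N ≡ divP z^N-1 g
  Φ-N = proj₂ (proj₂ (Φ-unfold n))

  IH-M : Invariant M
  IH-M = smaller M (n∣m*n p) (n<p*n M p-prime)

  degree-g : degree g ≡ ℕ-Products.properDivisorProduct N (degree ∘ Φ)
  degree-g = Measure.μ-properFactors ℕP.+-0-isCommutativeMonoid degree degree-mulP refl

  jet-g : jet g ≡ Jet-Products.properDivisorProduct N (jet ∘ Φ)
  jet-g = Measure.μ-properFactors ·-isCommutativeMonoid jet jet-mulP refl

  N≡K+degree-g : N ≡ K ℕ.+ degree g
  N≡K+degree-g = ℕP.+-cancelʳ-≡ (degree (Φ M)) N (K ℕ.+ degree g) (begin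
    N ℕ.+ degree (Φ M)                          ≡⟨ möbius ⟩
    p ℕ.* degree (Φ M) ℕ.+ degree g             ≡⟨ ℕP.+-assoc (degree (Φ M)) K (degree g) ⟩
    degree (Φ M) ℕ.+ (K ℕ.+ degree g)           ≡⟨ ℕP.+-comm (degree (Φ M)) _ ⟩
    K ℕ.+ degree g ℕ.+ degree (Φ M)             ∎)
    where
    möbius : N ℕ.+ degree (Φ M) ≡ p ℕ.* degree (Φ M) ℕ.+ degree g
    möbius = trans (ℕ-Products.Möbius.u-p*M-∙-T (p ℕ.*_) (ℕP.*-distribˡ-+ p) (ℕP.*-zeroʳ p) ℕP.+-cancelʳ-≡
                      p-prime p∤M (degree ∘ Φ) (λ D → D) (λ _ _ → refl) (λ D D∣N D<N → degree-sum (smaller D D∣N D<N)))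
                   (cong (p ℕ.* degree (Φ M) ℕ.+_) (sym degree-g))

  degree-z^N-1 : degree z^N-1 ≡ K ℕ.+ degree g
  degree-z^N-1 = trans (degree-zPowMinusOne n) N≡K+degree-g

  g≤z^N-1 : degree g ≤ degree z^N-1
  g≤z^N-1 = subst (degree g ≤_) (sym degree-z^N-1) (ℕP.m≤n+m (degree g) K)

  degree-quotient : degree z^N-1 ∸ degree g ≡ K
  degree-quotient = trans (cong (_∸ degree g) degree-z^N-1) (ℕP.m+n∸n≡m K (degree g))

  monic-g : Monic g
  monic-g = monic-factors n ℕP.≤-refl [] refl

  monic-Φ-N : Monic (Φ N)
  monic-Φ-N = subst Monic (sym Φ-N) (divP-monic z^N-1 g (zPowMinusOne-monic n) monic-g g≤z^N-1)

  degree-Φ-N : degree (Φ N) ≡ K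
  degree-Φ-N = trans (cong degree Φ-N) (trans (degree-divP z^N-1 g (zPowMinusOne-monic n) monic-g g≤z^N-1) degree-quotient)

  degree-sum-N : ℕ-Products.divisorProduct N (degree ∘ Φ) ≡ N
  degree-sum-N = begin
    ℕ-Products.divisorProduct N (degree ∘ Φ)                       ≡⟨ ℕ-Products.divisorProduct-proper N (degree ∘ Φ) ⟩
    ℕ-Products.properDivisorProduct N (degree ∘ Φ) ℕ.+ degree (Φ N) ≡⟨ cong₂ ℕ._+_ (sym degree-g) degree-Φ-N ⟩
    degree g ℕ.+ K                                                 ≡⟨ ℕP.+-comm (degree g) K ⟩
    K ℕ.+ degree g                                                 ≡⟨ N≡K+degree-g ⟨
    N                                                              ∎

  module _ (3≤K : 3 ≤ K) where
    jet-Φ-N·jet-g : jet (Φ N) · jet g ≡ oneMinusPow N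
    jet-Φ-N·jet-g = begin
      jet (Φ N) · jet g
        ≡⟨ jetOf-conv (topCoeff (Φ N)) (topCoeff g) monic-Φ-N monic-g ⟨
      jetOf (conv (topCoeff (Φ N)) (topCoeff g))
        ≡⟨ ⟨⟩-cong (reproduces 1 (s≤s z≤n)) (reproduces 2 (s≤s (s≤s z≤n))) (reproduces 3 ℕP.≤-refl) ⟩
      jet z^N-1
        ≡⟨ jet-zPowMinusOne n ⟩
      oneMinusPow N ∎
      where
      reproduces : ∀ k → k ≤ 3 → conv (topCoeff (Φ N)) (topCoeff g) k ≡ topCoeff z^N-1 k
      reproduces k k≤3 rewrite Φ-N = divP-conv z^N-1 g (zPowMinusOne-monic n) monic-g g≤z^N-1 k
                                       (subst (k ≤_) (sym degree-quotient) (ℕP.≤-trans k≤3 3≤K))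

    jet-product-N : Jet-Products.divisorProduct N (jet ∘ Φ) ≡ oneMinusPow N
    jet-product-N = begin
      Jet-Products.divisorProduct N (jet ∘ Φ)                  ≡⟨ Jet-Products.divisorProduct-proper N (jet ∘ Φ) ⟩
      Jet-Products.properDivisorProduct N (jet ∘ Φ) · jet (Φ N) ≡⟨ cong (_· jet (Φ N)) jet-g ⟨
      jet g · jet (Φ N)                                        ≡⟨ ·-comm (jet g) (jet (Φ N)) ⟩
      jet (Φ N) · jet g                                        ≡⟨ jet-Φ-N·jet-g ⟩
      oneMinusPow N                                            ∎

    jet-Φ-N·jet-Φ-M : jet (Φ N) · jet (Φ M) ≡ dilate p (jet (Φ M))
    jet-Φ-N·jet-Φ-M = ·-cancelʳ (jet g) _ _ (begin
      jet (Φ N) · jet (Φ M) · jet g             ≡⟨ xy·z≡xz·y (jet (Φ N)) (jet (Φ M)) (jet g) ⟩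
      jet (Φ N) · jet g · jet (Φ M)             ≡⟨ cong (_· jet (Φ M)) jet-Φ-N·jet-g ⟩
      oneMinusPow N · jet (Φ M)                 ≡⟨ möbius ⟩
      dilate p (jet (Φ M)) · jet g              ∎)
      where
      möbius : oneMinusPow N · jet (Φ M) ≡ dilate p (jet (Φ M)) · jet g
      möbius = trans (Jet-Products.Möbius.u-p*M-∙-T (dilate p) (dilate-· p) (dilate-1ʲ p) ·-cancelʳ
                        p-prime p∤M (jet ∘ Φ) oneMinusPow
                        (λ E E∣M → dilate-oneMinusPow p E (prime>1 p-prime) (ℕ.>-nonZero⁻¹ E {{∣⇒nonZero E∣M}}))
                        (λ D D∣N D<N → jet-product (smaller D D∣N D<N)))
                     (cong (dilate p (jet (Φ M)) ·_) (sym jet-g))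

  invariant : Invariant N
  invariant with size-step q p-prime p∤M (size IH-M)
  ... | inj₂ small = small-invariant small
  ... | inj₁ 3≤K   = record
    { monic       = monic-Φ-N
    ; degree-sum  = degree-sum-N
    ; jet-product = jet-product-N 3≤K
    ; size        = inj₁ (subst (3 ≤_) (sym degree-Φ-N) 3≤K)
    ; shape       = shape-step p-prime p∤M (shape IH-M) (jet-Φ-N·jet-Φ-M 3≤K)
    }

invariant : ∀ N → NonZero N → Squarefree N → Invariant N
invariant = <-rec _ step
  where
  step : ∀ N → (∀ {d} → d < N → NonZero d → Squarefree d → Invariant d) → NonZero N → Squarefree N → Invariant N
  step 1 _ _ _ = small-invariant one
  step N@(suc (suc _)) smaller-invariant _ N-squarefree with prime-split N (s≤s (s≤s z≤n))
  ... | q , m , p-prime , N≡pM = subst Invariant (sym N≡pM) (InductionStep.invariant q m p-prime p∤M smaller)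
    where
    p∤M : ¬ suc q ∣ suc m
    p∤M p∣M = N-squarefree (suc q) p-prime (subst (suc q ℕ.* suc q ∣_) (sym N≡pM) (*-monoʳ-∣ (suc q) p∣M))
    smaller : ∀ d → d ∣ suc q ℕ.* suc m → d < suc q ℕ.* suc m → Invariant d
    smaller d d∣pM d<pM = smaller-invariant (subst (d <_) (sym N≡pM) d<pM) (∣⇒nonZero d∣pM)
                            (squarefree-∣ N-squarefree (subst (d ∣_) (sym N≡pM) d∣pM))

lemma2p2 : (n : ℕ) → Squarefree n →
    (a 0 n ≡ + 1) ×
    ((a 1 n , a 2 n , a 3 n) ∈
      ((+ 1 , + 1 , + 1) ∷ (+ 1 , + 1 , + 0) ∷ (+ 1 , + 0 , + 0) ∷ (+ 1 , + 0 , - + 1) ∷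
       (- + 1 , + 1 , + 0) ∷ (- + 1 , + 1 , - + 1) ∷ (- + 1 , + 0 , + 1) ∷ (- + 1 , + 0 , + 0) ∷ []))
lemma2p2 zero n-squarefree = contradiction (divides 0 refl) (n-squarefree 2 prime[2])
lemma2p2 n@(suc _) n-squarefree =
  trans (a≡topCoeff 0 n) (monic Φ-n) ,
  subst (_∈ cyclotomicTriples) (sym a₁₂₃≡jet) (hasShape-triples (does (2 ∣? n)) (does (3 ∣? n)) (shape Φ-n))
  where
  open Invariant
  Φ-n : Invariant n
  Φ-n = invariant n _ n-squarefree
  a₁₂₃≡jet : (a 1 n , a 2 n , a 3 n) ≡ (Jet.c₁ (jet (Φ n)) , Jet.c₂ (jet (Φ n)) , Jet.c₃ (jet (Φ n)))
  a₁₂₃≡jet = cong₂ _,_ (a≡topCoeff 1 n) (cong₂ _,_ (a≡topCoeff 2 n) (a≡topCoeff 3 n))
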